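{- Let $s\ge1$, let $p$ and $q$ be odd primes and $m$ a natural number such that $\gcd(m,2pq)=1$, $\gcd(p^{s-1},\mathrm{ord}_2(m))=1$, $r_2(q)=\sum_{j=1}^s r_2(p^j)$, and $\gcd(\mathrm{ord}_2(p),\mathrm{ord}_2(m))=\gcd(\mathrm{ord}_2(q),\mathrm{ord}_2(m))$. Then $i_2(p^s m)=i_2(qm)$.
   Context: For odd $d\ge1$, $\mathrm{ord}_2(d)$ is the least $r\ge1$ with $2^r\equiv1\pmod d$, $r_2(d)=\varphi(d)/\mathrm{ord}_2(d)$, and $i_2(d)=\sum_{\delta\mid d}\varphi(\delta)/\mathrm{ord}_2(\delta)$. -}

module Defs where

open import Data.Nat using (ℕ; zero; suc; _+_; _^_; _≡ᵇ_; _/_)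
open import Data.Nat.DivMod using (_%_)
open import Data.Nat.GCD using (gcd)
open import Data.Bool using (Bool; true; false; if_then_else_)
open import Data.List using (List; []; _∷_; filter; length; map; upTo)
open import Data.Nat.ListAction using (sum)
open import Data.Nat.Divisibility using (_∣?_)
open import Relation.Nullary.Decidable using (⌊_⌋)
open import Relation.Unary using (Pred)

φ : ℕ → ℕ
φ d = length (filter (λ k → gcd (suc k) d Data.Nat.≟ 1) (upTo d))

divisors : ℕ → List ℕ
divisors d = filter (λ δ → δ ∣? d) (map suc (upTo d))

-- Search for the least r in {1,…,n} (starting at r = i) with 2^r ≡ 1 (mod d).
-- Returns r - 1, so that the order is of the form suc _ (nonzero divisor).
ordSearch : ℕ → ℕ → ℕ → ℕ
ordSearch d zero      i = i
ordSearch d (suc fuel) i =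
  if (2 ^ suc i) % suc d ≡ᵇ 1 % suc d then i else ordSearch d fuel (suc i)

-- For odd d this r exists and r ≤ d,
-- so searching r = 1,…,d suffices (the fallback value is never reached for odd d).
ord₂ : ℕ → ℕ
ord₂ zero    = 1   -- junk value, never used (d ≥ 1 throughout)
ord₂ (suc n) = suc (ordSearch n (suc n) 0)

r₂ : ℕ → ℕ
r₂ zero    = 0     -- junk value, never used
r₂ (suc n) = φ (suc n) / suc (ordSearch n (suc n) 0)

i₂ : ℕ → ℕ
i₂ d = sum (map r₂ (divisors d))

sumFrom1 : ℕ → (ℕ → ℕ) → ℕ
sumFrom1 zero    f = 0
sumFrom1 (suc s) f = sumFrom1 s f + f (suc s)

{-# OPTIONS --safe #-}

-- Write o(d) for ord₂ d.  For coprime odd a and b, φ(ab) = φ(a) φ(b) by the Chinese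
-- remainder theorem and o(ab) = lcm(o(a), o(b)), hence r₂(ab) = r₂(a) r₂(b) gcd(o(a), o(b)).
-- The divisors of p^s m are the products δ p^j with δ ∣ m and j ≤ s, and those of q m are
-- δ and δ q, so it suffices to show Σ_{j=1}^s r₂(δ p^j) = r₂(δ q) for every δ ∣ m.
-- Lifting the exponent gives o(p) ∣ o(p^j) ∣ o(p) p^(j-1); since p^(s-1) is coprime to
-- o(δ) ∣ o(m), gcd(o(δ), o(p^j)) = gcd(o(δ), o(p)) = gcd(o(δ), o(q)), the last step by the
-- hypothesis on o(m).  So both sides are r₂(δ) gcd(o(δ), o(q)) times Σ_j r₂(p^j) = r₂(q).

module Submission where

open import Defs
open import Data.Nat using (ℕ; _*_; _^_; _∸_; _≥_)
open import Data.Nat.GCD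
open import Data.Nat.Primality using (Prime; prime⇒irreducible; prime⇒nonZero; prime⇒nonTrivial)
open import Data.Nat.DivMod
open import Relation.Binary.PropositionalEquality
  using (_≡_; _≢_; refl; sym; trans; cong; cong₂; subst; subst₂; ≢-sym; module ≡-Reasoning)

open import Data.Nat.Base
  using (zero; suc; _+_; _≤_; _<_; z≤n; s≤s; s<s⁻¹; s≤s⁻¹; _≡ᵇ_; NonZero; ≢-nonZero; ≢-nonZero⁻¹; nonTrivial⇒n>1)
open import Data.Nat.Properties
open import Data.Nat.Divisibility
open import Data.Nat.Coprimality as Coprime using (Coprime; coprime-divisor; gcd≡1⇒coprime; coprime⇒gcd≡1)
open import Data.Nat.LCM using (lcm; m∣lcm[m,n]; n∣lcm[m,n]; lcm-least; gcd*lcm)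
open import Data.Nat.ListAction using (sum; product)
open import Data.Nat.ListAction.Properties using (sum-↭; sum-++; product-↭)
open import Data.Nat.Solver using (module +-*-Solver)
open +-*-Solver using (solve; _:+_; _:*_; _:=_; con)
open import Algebra.Properties.CommutativeSemigroup *-commutativeSemigroup using (xy∙z≈y∙xz)
open import Data.List.Base using (List; []; _∷_; _++_; [_]; length; map; filter; upTo; cartesianProduct)
open import Data.List.Properties
  using (length-++; length-map; length-filter; length-upTo; ++-identityʳ; map-++; map-∘; map-upTo;
         map-cong-local; filter-++; filter-some; upTo-∷ʳ)
open import Data.List.Membership.Propositional using (_∈_)
open import Data.List.Membership.Propositional.Properties
  using (∈-∃++; ∈-map⁻; ∈-map⁺; ∈-filter⁻; ∈-filter⁺; ∈-upTo⁻; ∈-upTo⁺;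
         ∈-cartesianProduct⁻; ∈-cartesianProduct⁺)
open import Data.List.Relation.Unary.Any using (here; there)
open import Data.List.Relation.Unary.All as All using (All)
import Data.List.Relation.Unary.All.Properties as All
open import Data.List.Relation.Unary.AllPairs using ([]; _∷_)
open import Data.List.Relation.Unary.Unique.Propositional using (Unique)
open import Data.List.Relation.Unary.Unique.Propositional.Properties using (filter⁺; upTo⁺; cartesianProduct⁺)
open import Data.List.Relation.Binary.Subset.Propositional using (_⊆_)
open import Data.List.Relation.Binary.Permutation.Propositional using (_↭_; ↭-refl; ↭-trans; ↭-prep; ↭⇒↭ₛ)
open import Data.List.Relation.Binary.Permutation.Propositional.Properties
  using (shift; ∈-resp-↭; ↭-length) renaming (map⁺ to ↭-map⁺)
import Data.List.Relation.Binary.Permutation.Setoid.Properties as Setoid↭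
open import Data.Product using (∃-syntax; _×_; _,_; proj₁; proj₂; uncurry)
open import Data.Sum using (_⊎_; inj₁; inj₂; map₂)
open import Data.Bool.Base using (true; false; T)
open import Data.Empty using (⊥-elim)
open import Function using (_∘_)
open import Relation.Binary.PropositionalEquality.Properties using (setoid)
open import Relation.Binary.Definitions using (tri<; tri≈; tri>)
open import Relation.Nullary using (¬_; yes; no; does)
open import Relation.Unary using (Decidable)

private
  variable
    A B : Set
    xs ys : List A

∈⇒↭∷ : ∀ {x} → x ∈ xs → ∃[ ys ] xs ↭ x ∷ ys
∈⇒↭∷ x∈xs with ys , zs , refl ← ∈-∃++ x∈xs = ys ++ zs , shift _ ys zs

unique-resp-↭ : xs ↭ ys → Unique xs → Unique ys
unique-resp-↭ xs↭ys = Setoid↭.Unique-resp-↭ (setoid _) (↭⇒↭ₛ xs↭ys)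

∈-∷-≢ : ∀ {x y} → x ∈ y ∷ ys → x ≢ y → x ∈ ys
∈-∷-≢ (here x≡y) x≢y = ⊥-elim (x≢y x≡y)
∈-∷-≢ (there x∈ys) _ = x∈ys

unique-⊆⇒↭++ : Unique xs → Unique ys → xs ⊆ ys → ∃[ zs ] ys ↭ xs ++ zs
unique-⊆⇒↭++ {xs = []} {ys = ys} _ _ _ = ys , ↭-refl
unique-⊆⇒↭++ {xs = x ∷ xs} (x∉xs ∷ uxs) uys xs⊆ys
  with ys′ , ys↭x∷ys′ ← ∈⇒↭∷ (xs⊆ys (here refl))
  with _ ∷ uys′ ← unique-resp-↭ ys↭x∷ys′ uys
  with zs , ys′↭ ← unique-⊆⇒↭++ uxs uys′ (λ y∈xs →
         ∈-∷-≢ (∈-resp-↭ ys↭x∷ys′ (xs⊆ys (there y∈xs))) (≢-sym (All.lookup x∉xs y∈xs)))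
  = zs , ↭-trans ys↭x∷ys′ (↭-prep x ys′↭)

unique-⊆⇒length≤ : Unique xs → Unique ys → xs ⊆ ys → length xs ≤ length ys
unique-⊆⇒length≤ {xs = xs} uxs uys xs⊆ys with zs , ys↭ ← unique-⊆⇒↭++ uxs uys xs⊆ys =
  subst (length xs ≤_) (sym (trans (↭-length ys↭) (length-++ xs))) (m≤m+n _ _)

unique-⊆-length≤⇒↭ : Unique xs → Unique ys → xs ⊆ ys → length ys ≤ length xs → ys ↭ xs
unique-⊆-length≤⇒↭ {xs = xs} uxs uys xs⊆ys ys≤xs with unique-⊆⇒↭++ uxs uys xs⊆ys
... | [] , ys↭ = subst (_ ↭_) (++-identityʳ xs) ys↭
... | z ∷ zs , ys↭ =
  ⊥-elim (m+1+n≰m (length xs) (subst (_≤ length xs) (trans (↭-length ys↭) (length-++ xs)) ys≤xs))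

unique-⊆⊇⇒↭ : Unique xs → Unique ys → xs ⊆ ys → ys ⊆ xs → ys ↭ xs
unique-⊆⊇⇒↭ uxs uys xs⊆ys ys⊆xs = unique-⊆-length≤⇒↭ uxs uys xs⊆ys (unique-⊆⇒length≤ uys uxs ys⊆xs)

unique-map⁺ : ∀ (f : A → B) → (∀ {x y} → x ∈ xs → y ∈ xs → f x ≡ f y → x ≡ y) →
              Unique xs → Unique (map f xs)
unique-map⁺ f inj [] = []
unique-map⁺ f inj (x∉xs ∷ uxs) =
  All.map⁺ (All.tabulate λ y∈xs fx≡fy → All.lookup x∉xs y∈xs (inj (here refl) (there y∈xs) fx≡fy))
  ∷ unique-map⁺ f (λ x∈xs y∈xs → inj (there x∈xs) (there y∈xs)) uxs

filter-map : ∀ {P : B → Set} (P? : Decidable P) (f : A → B) xs →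
             filter P? (map f xs) ≡ map f (filter (P? ∘ f) xs)
filter-map P? f []       = refl
filter-map P? f (x ∷ xs) with does (P? (f x))
... | true  = cong (f x ∷_) (filter-map P? f xs)
... | false = filter-map P? f xs

length-filter-[]-cong : ∀ {P : A → Set} (P? : Decidable P) {x y} → (P x → P y) → (P y → P x) →
                        length (filter P? [ x ]) ≡ length (filter P? [ y ])
length-filter-[]-cong P? {x} {y} Px⇒Py Py⇒Px with P? x | P? y
... | yes _  | yes _  = refl
... | no  _  | no  _  = refl
... | yes Px | no ¬Py = ⊥-elim (¬Py (Px⇒Py Px))
... | no ¬Px | yes Py = ⊥-elim (¬Px (Py⇒Px Py))

length-cartesianProduct : ∀ (xs : List A) (ys : List B) → length (cartesianProduct xs ys) ≡ length xs * length ys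
length-cartesianProduct []       ys = refl
length-cartesianProduct (x ∷ xs) ys =
  trans (length-++ (map (x ,_) ys)) (cong₂ _+_ (length-map (x ,_) ys) (length-cartesianProduct xs ys))

sum-map-cartesianProduct : ∀ (f : A × B → ℕ) xs ys →
  sum (map f (cartesianProduct xs ys)) ≡ sum (map (λ x → sum (map (λ y → f (x , y)) ys)) xs)
sum-map-cartesianProduct f []       ys = refl
sum-map-cartesianProduct f (x ∷ xs) ys = begin
  sum (map f (map (x ,_) ys ++ cartesianProduct xs ys))
    ≡⟨ cong sum (map-++ f (map (x ,_) ys) _) ⟩
  sum (map f (map (x ,_) ys) ++ map f (cartesianProduct xs ys))
    ≡⟨ sum-++ (map f (map (x ,_) ys)) _ ⟩
  sum (map f (map (x ,_) ys)) + sum (map f (cartesianProduct xs ys))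
    ≡⟨ cong₂ _+_ (cong sum (sym (map-∘ ys))) (sum-map-cartesianProduct f xs ys) ⟩
  sum (map (λ y → f (x , y)) ys) + sum (map (λ x → sum (map (λ y → f (x , y)) ys)) xs)
    ∎
  where open ≡-Reasoning

sum-map-upTo-suc : ∀ (f : ℕ → ℕ) s → sum (map f (upTo (suc s))) ≡ f 0 + sumFrom1 s f
sum-map-upTo-suc f zero    = refl
sum-map-upTo-suc f (suc s) = begin
  sum (map f (upTo (suc (suc s))))              ≡⟨ cong (sum ∘ map f) (upTo-∷ʳ (suc s)) ⟨
  sum (map f (upTo (suc s) ++ [ suc s ]))       ≡⟨ cong sum (map-++ f (upTo (suc s)) [ suc s ]) ⟩
  sum (map f (upTo (suc s)) ++ [ f (suc s) ])   ≡⟨ sum-++ (map f (upTo (suc s))) _ ⟩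
  sum (map f (upTo (suc s))) + (f (suc s) + 0)  ≡⟨ cong₂ _+_ (sum-map-upTo-suc f s) (+-identityʳ _) ⟩
  f 0 + sumFrom1 s f + f (suc s)                ≡⟨ +-assoc (f 0) _ _ ⟩
  f 0 + sumFrom1 (suc s) f                      ∎
  where open ≡-Reasoning

sumFrom1-cong : ∀ s {f g : ℕ → ℕ} → (∀ {j} → 1 ≤ j → j ≤ s → f j ≡ g j) → sumFrom1 s f ≡ sumFrom1 s g
sumFrom1-cong zero    f≡g = refl
sumFrom1-cong (suc s) f≡g =
  cong₂ _+_ (sumFrom1-cong s (λ 1≤j j≤s → f≡g 1≤j (m≤n⇒m≤1+n j≤s))) (f≡g (s≤s z≤n) ≤-refl)

sumFrom1-*-distribʳ : ∀ s (f : ℕ → ℕ) c → sumFrom1 s (λ j → f j * c) ≡ sumFrom1 s f * c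
sumFrom1-*-distribʳ zero    f c = refl
sumFrom1-*-distribʳ (suc s) f c =
  trans (cong (_+ f (suc s) * c) (sumFrom1-*-distribʳ s f c)) (sym (*-distribʳ-+ c (sumFrom1 s f) (f (suc s))))

%≡%⇒∣∸ : ∀ {a b} n .{{_ : NonZero n}} → a % n ≡ b % n → n ∣ a ∸ b
%≡%⇒∣∸ {a} {b} n a≡b = divides (a / n ∸ b / n) (begin
  a ∸ b                                     ≡⟨ cong₂ _∸_ (m≡m%n+[m/n]*n a n) (m≡m%n+[m/n]*n b n) ⟩
  (a % n + a / n * n) ∸ (b % n + b / n * n) ≡⟨ cong (λ r → (r + a / n * n) ∸ (b % n + b / n * n)) a≡b ⟩
  (b % n + a / n * n) ∸ (b % n + b / n * n) ≡⟨ [m+n]∸[m+o]≡n∸o (b % n) _ _ ⟩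
  a / n * n ∸ b / n * n                     ≡⟨ *-distribʳ-∸ n (a / n) (b / n) ⟨
  (a / n ∸ b / n) * n                       ∎)
  where open ≡-Reasoning

∣∸⇒%≡% : ∀ {a b} n .{{_ : NonZero n}} → b ≤ a → n ∣ a ∸ b → a % n ≡ b % n
∣∸⇒%≡% {a} {b} n b≤a (divides k a∸b≡k*n) = begin
  a % n             ≡⟨ cong (_% n) (m+[n∸m]≡n b≤a) ⟨
  (b + (a ∸ b)) % n ≡⟨ cong (λ x → (b + x) % n) a∸b≡k*n ⟩
  (b + k * n) % n   ≡⟨ [m+kn]%n≡m%n b k n ⟩
  b % n             ∎
  where open ≡-Reasoning

∣∸∧∣∸⇒≡ : ∀ {a b n} → a < n → b < n → n ∣ a ∸ b → n ∣ b ∸ a → a ≡ b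
∣∸∧∣∸⇒≡ {a} {b} a<n b<n n∣a∸b n∣b∸a =
  ≤-antisym (m∸n≡0⇒m≤n (∣∧<⇒≡0 n∣a∸b (≤-<-trans (m∸n≤m a b) a<n)))
            (m∸n≡0⇒m≤n (∣∧<⇒≡0 n∣b∸a (≤-<-trans (m∸n≤m b a) b<n)))
  where
  ∣∧<⇒≡0 : ∀ {n x} → n ∣ x → x < n → x ≡ 0
  ∣∧<⇒≡0 {x = zero}  _   _   = refl
  ∣∧<⇒≡0 {x = suc x} n∣x x<n = ⊥-elim (<⇒≱ x<n (∣⇒≤ n∣x))

coprime-∣ʳ : ∀ {m n o} → Coprime m n → o ∣ n → Coprime m o
coprime-∣ʳ m⊥n o∣n (i∣m , i∣o) = m⊥n (i∣m , ∣-trans i∣o o∣n)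

coprime-∣ˡ : ∀ {m n o} → Coprime m n → o ∣ m → Coprime o n
coprime-∣ˡ m⊥n o∣m (i∣o , i∣n) = m⊥n (∣-trans i∣o o∣m , i∣n)

coprime-* : ∀ {m n o} → Coprime m n → Coprime m o → Coprime m (n * o)
coprime-* m⊥n m⊥o (i∣m , i∣no) = m⊥o (i∣m , coprime-divisor (coprime-∣ˡ m⊥n i∣m) i∣no)

coprime-^ : ∀ {m n} → Coprime m n → ∀ k → Coprime m (n ^ k)
coprime-^ m⊥n zero    (_ , i∣1) = ∣1⇒≡1 i∣1
coprime-^ m⊥n (suc k) = coprime-* m⊥n (coprime-^ m⊥n k)

coprime-product : ∀ {m us} → All (Coprime m) us → Coprime m (product us)
coprime-product All.[]          (_ , i∣1) = ∣1⇒≡1 i∣1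
coprime-product (m⊥u All.∷ m⊥us) = coprime-* m⊥u (coprime-product m⊥us)

coprime-%ˡ : ∀ {m n} .{{_ : NonZero n}} → Coprime m n → Coprime (m % n) n
coprime-%ˡ m⊥n (i∣m%n , i∣n) = m⊥n (∣n∣m%n⇒∣m i∣n i∣m%n , i∣n)

coprime-%ˡ⁻ : ∀ {m n} .{{_ : NonZero n}} → Coprime (m % n) n → Coprime m n
coprime-%ˡ⁻ m%n⊥n (i∣m , i∣n) = m%n⊥n (%-presˡ-∣ i∣m i∣n , i∣n)

coprime⇒*∣ : ∀ {m n o} → Coprime m n → m ∣ o → n ∣ o → m * n ∣ o
coprime⇒*∣ {m} {n} m⊥n (divides k o≡k*m) n∣o =
  subst (m * n ∣_) (sym o≡m*k) (*-monoʳ-∣ m (coprime-divisor (Coprime.sym m⊥n) (subst (n ∣_) o≡m*k n∣o)))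
  where o≡m*k = trans o≡k*m (*-comm k m)

coprime-∣*∸*⇒∣∸ : ∀ {n c a b} → Coprime n c → n ∣ c * a ∸ c * b → n ∣ a ∸ b
coprime-∣*∸*⇒∣∸ {n} {c} {a} {b} n⊥c n∣ca∸cb =
  coprime-divisor n⊥c (subst (n ∣_) (sym (*-distribˡ-∸ c a b)) n∣ca∸cb)

coprime-2⇒NonZero : ∀ {n} → Coprime 2 n → NonZero n
coprime-2⇒NonZero {zero}  2⊥0 with () ← 2⊥0 (∣-refl , 2 ∣0)
coprime-2⇒NonZero {suc _} _   = _

odd⇒coprime-2 : ∀ {n} → n % 2 ≡ 1 → Coprime 2 n
odd⇒coprime-2 n%2≡1 {i} (i∣2 , i∣n) = ∣1⇒≡1 (subst (i ∣_) n%2≡1 (%-presˡ-∣ i∣n i∣2))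

∣∸1-* : ∀ {d} a b → d ∣ a ∸ 1 → d ∣ b ∸ 1 → d ∣ a * b ∸ 1
∣∸1-* {d} zero    b       _   _   = d ∣0
∣∸1-* {d} (suc a) zero    _   _   = subst (λ x → d ∣ x ∸ 1) (sym (*-zeroʳ a)) (d ∣0)
∣∸1-* {d} (suc a) (suc b) d∣a d∣b = ∣m∣n⇒∣m+n d∣b (∣m⇒∣m*n (suc b) d∣a)

∣∸1-*-cancelˡ : ∀ {d} a b .{{_ : NonZero a}} → d ∣ a * b ∸ 1 → d ∣ a ∸ 1 → d ∣ b ∸ 1
∣∸1-*-cancelˡ {d} (suc a) zero    _    _   = d ∣0
∣∸1-*-cancelˡ {d} (suc a) (suc b) d∣ab d∣a =
  ∣m+n∣m⇒∣n (subst (d ∣_) (+-comm b (a * suc b)) d∣ab) (∣m⇒∣m*n (suc b) d∣a)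

∣∸1-^ : ∀ {d a} → d ∣ a ∸ 1 → ∀ k → d ∣ a ^ k ∸ 1
∣∸1-^ {d}     _   zero    = d ∣0
∣∸1-^ {d} {a} d∣a (suc k) = ∣∸1-* a (a ^ k) d∣a (∣∸1-^ d∣a k)

∣⇒gcd≡ : ∀ {m n} → n ∣ m → gcd m n ≡ n
∣⇒gcd≡ {m} {n} n∣m = ∣-antisym (gcd[m,n]∣n m n) (gcd-greatest n∣m ∣-refl)

gcd[o,gcd[n,x]]≡gcd[o,x] : ∀ {o n} x → o ∣ n → gcd o (gcd n x) ≡ gcd o x
gcd[o,gcd[n,x]]≡gcd[o,x] {o} {n} x o∣n =
  trans (sym (gcd-assoc o n x)) (cong (λ g → gcd g x) (trans (gcd-comm o n) (∣⇒gcd≡ o∣n)))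

gcd-cong-∣ : ∀ {o n x y} → o ∣ n → gcd n x ≡ gcd n y → gcd o x ≡ gcd o y
gcd-cong-∣ {o} {n} {x} {y} o∣n gcd[n,x]≡gcd[n,y] = begin
  gcd o x           ≡⟨ gcd[o,gcd[n,x]]≡gcd[o,x] x o∣n ⟨
  gcd o (gcd n x)   ≡⟨ cong (gcd o) gcd[n,x]≡gcd[n,y] ⟩
  gcd o (gcd n y)   ≡⟨ gcd[o,gcd[n,x]]≡gcd[o,x] y o∣n ⟩
  gcd o y           ∎
  where open ≡-Reasoning

gcd-coprime-factor : ∀ {m n c x} → m ∣ n → n ∣ m * c → Coprime c x → gcd x n ≡ gcd x m
gcd-coprime-factor {m} {n} {c} {x} m∣n n∣mc c⊥x = ∣-antisym
  (gcd-greatest g∣x (coprime-divisor (Coprime.sym (coprime-∣ʳ c⊥x g∣x)) g∣c*m))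
  (gcd-greatest (gcd[m,n]∣m x m) (∣-trans (gcd[m,n]∣n x m) m∣n))
  where
  g = gcd x n
  g∣x = gcd[m,n]∣m x n
  g∣c*m = subst (g ∣_) (*-comm m c) (∣-trans (gcd[m,n]∣n x n) n∣mc)

-- Euler's theorem

units : ℕ → List ℕ
units d = filter (λ k → gcd k d ≟ 1) (upTo d)

-- φ d counts 1, …, d whereas units d lists 0, …, d - 1: the ranges differ in 0 versus d,
-- which have the same gcd with d.
φ≡length-units : ∀ d → φ d ≡ length (units d)
φ≡length-units d = +-cancelˡ-≡ (count [ d ]) _ _ (begin
  count [ d ] + φ d                               ≡⟨ cong (_+ φ d) count[d]≡count[0] ⟩
  count [ 0 ] + φ d                               ≡⟨ cong (count [ 0 ] +_) (length-map suc (filter (P? ∘ suc) (upTo d))) ⟨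
  count [ 0 ] + length (map suc (filter (P? ∘ suc) (upTo d)))
                                                  ≡⟨ cong (λ xs → count [ 0 ] + length xs) (filter-map P? suc (upTo d)) ⟨
  count [ 0 ] + count (map suc (upTo d))          ≡⟨ count-++ [ 0 ] _ ⟨
  count ([ 0 ] ++ map suc (upTo d))               ≡⟨ cong (λ xs → count ([ 0 ] ++ xs)) (map-upTo suc d) ⟩
  count (upTo (suc d))                            ≡⟨ cong count (upTo-∷ʳ d) ⟨
  count (upTo d ++ [ d ])                         ≡⟨ count-++ (upTo d) [ d ] ⟩
  length (units d) + count [ d ]                  ≡⟨ +-comm (length (units d)) _ ⟩
  count [ d ] + length (units d)                  ∎)
  where
  open ≡-Reasoning
  P? : Decidable (λ k → gcd k d ≡ 1)
  P? k = gcd k d ≟ 1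
  count : List ℕ → ℕ
  count xs = length (filter P? xs)
  count-++ : ∀ xs ys → count (xs ++ ys) ≡ count xs + count ys
  count-++ xs ys = trans (cong length (filter-++ P? xs ys)) (length-++ (filter P? xs))
  gcd[d,d]≡gcd[0,d] : gcd d d ≡ gcd 0 d
  gcd[d,d]≡gcd[0,d] = trans (∣⇒gcd≡ ∣-refl) (sym (gcd-identityˡ d))
  count[d]≡count[0] : count [ d ] ≡ count [ 0 ]
  count[d]≡count[0] = length-filter-[]-cong P? {d} {0} (trans (sym gcd[d,d]≡gcd[0,d])) (trans gcd[d,d]≡gcd[0,d])

∈-units⁻ : ∀ {d u} → u ∈ units d → u < d × Coprime u d
∈-units⁻ {d} u∈units with u∈upTo , gcd≡1 ← ∈-filter⁻ (λ k → gcd k d ≟ 1) u∈units =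
  ∈-upTo⁻ u∈upTo , gcd≡1⇒coprime gcd≡1

∈-units⁺ : ∀ {d u} → u < d → Coprime u d → u ∈ units d
∈-units⁺ {d} u<d u⊥d = ∈-filter⁺ (λ k → gcd k d ≟ 1) (∈-upTo⁺ u<d) (coprime⇒gcd≡1 u⊥d)

units-unique : ∀ d → Unique (units d)
units-unique d = filter⁺ (λ k → gcd k d ≟ 1) (upTo⁺ d)

units-↭-*% : ∀ {a d} .{{_ : NonZero d}} → Coprime a d → units d ↭ map (λ u → (a * u) % d) (units d)
units-↭-*% {a} {d} a⊥d = unique-⊆-length≤⇒↭ (unique-map⁺ _ injective (units-unique d)) (units-unique d)
  image⊆units (≤-reflexive (sym (length-map _ (units d))))
  where
  d⊥a = Coprime.sym a⊥d
  injective : ∀ {u v} → u ∈ units d → v ∈ units d → (a * u) % d ≡ (a * v) % d → u ≡ v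
  injective u∈units v∈units au≡av =
    ∣∸∧∣∸⇒≡ (proj₁ (∈-units⁻ u∈units)) (proj₁ (∈-units⁻ v∈units))
      (coprime-∣*∸*⇒∣∸ d⊥a (%≡%⇒∣∸ d au≡av)) (coprime-∣*∸*⇒∣∸ d⊥a (%≡%⇒∣∸ d (sym au≡av)))
  image⊆units : map (λ u → (a * u) % d) (units d) ⊆ units d
  image⊆units w∈image with u , u∈units , refl ← ∈-map⁻ _ w∈image =
    ∈-units⁺ (m%n<n (a * u) d) (coprime-%ˡ (Coprime.sym (coprime-* d⊥a d⊥u)))
    where d⊥u = Coprime.sym (proj₂ (∈-units⁻ u∈units))

product-map-*% : ∀ a d .{{_ : NonZero d}} us →
                 product (map (λ u → (a * u) % d) us) % d ≡ (a ^ length us * product us) % d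
product-map-*% a d []       = refl
product-map-*% a d (u ∷ us) = begin
  ((a * u) % d * product (map _ us)) % d
    ≡⟨ %-distribˡ-* ((a * u) % d) _ d ⟩
  ((a * u) % d % d * (product (map _ us) % d)) % d
    ≡⟨ cong₂ (λ x y → (x * y) % d) (m%n%n≡m%n (a * u) d) (product-map-*% a d us) ⟩
  ((a * u) % d * ((a ^ length us * product us) % d)) % d
    ≡⟨ %-distribˡ-* (a * u) _ d ⟨
  ((a * u) * (a ^ length us * product us)) % d
    ≡⟨ cong (_% d) ([m*n]*[o*p]≡[m*o]*[n*p] a u (a ^ length us) (product us)) ⟩
  (a ^ length (u ∷ us) * product (u ∷ us)) % d
    ∎
  where open ≡-Reasoning

euler : ∀ {a d} .{{_ : NonZero d}} → Coprime a d → d ∣ a ^ φ d ∸ 1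
euler {a} {d} a⊥d = subst (λ k → d ∣ a ^ k ∸ 1) (sym (φ≡length-units d))
  (coprime-∣*∸*⇒∣∸ d⊥P (%≡%⇒∣∸ d P*a^L≡P*1))
  where
  open ≡-Reasoning
  L = length (units d)
  P = product (units d)
  d⊥P : Coprime d P
  d⊥P = coprime-product (All.tabulate (Coprime.sym ∘ proj₂ ∘ ∈-units⁻))
  P*a^L≡P*1 : (P * a ^ L) % d ≡ (P * 1) % d
  P*a^L≡P*1 = begin
    (P * a ^ L) % d                                 ≡⟨ cong (_% d) (*-comm P (a ^ L)) ⟩
    (a ^ L * P) % d                                 ≡⟨ product-map-*% a d (units d) ⟨
    product (map (λ u → (a * u) % d) (units d)) % d ≡⟨ cong (_% d) (product-↭ (units-↭-*% a⊥d)) ⟨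
    P % d                                           ≡⟨ cong (_% d) (*-identityʳ P) ⟨
    (P * 1) % d                                     ∎

0<φ : ∀ d .{{_ : NonZero d}} → 0 < φ d
0<φ (suc n) = filter-some (λ k → gcd (suc k) (suc n) ≟ 1) {upTo (suc n)} (here (gcd-zeroˡ (suc n)))

φ≤ : ∀ d → φ d ≤ d
φ≤ d = subst (φ d ≤_) (length-upTo d) (length-filter (λ k → gcd (suc k) d ≟ 1) (upTo d))

-- The multiplicative order of 2

T[x%d≡ᵇ1%d]⇒d∣x∸1 : ∀ {x} d .{{_ : NonZero d}} → T (x % d ≡ᵇ 1 % d) → d ∣ x ∸ 1
T[x%d≡ᵇ1%d]⇒d∣x∸1 {x} d x≡1 = %≡%⇒∣∸ d (≡ᵇ⇒≡ (x % d) (1 % d) x≡1)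

d∣x∸1⇒T[x%d≡ᵇ1%d] : ∀ {x} d .{{_ : NonZero d}} → 1 ≤ x → d ∣ x ∸ 1 → T (x % d ≡ᵇ 1 % d)
d∣x∸1⇒T[x%d≡ᵇ1%d] {x} d 1≤x d∣x∸1 = ≡⇒≡ᵇ (x % d) (1 % d) (∣∸⇒%≡% d 1≤x d∣x∸1)

ordSearch-minimal : ∀ n fuel {i j} → i ≤ j → j < ordSearch n fuel i → ¬ (suc n ∣ 2 ^ suc j ∸ 1)
ordSearch-minimal n zero       i≤j j<i = ⊥-elim (<⇒≱ j<i i≤j)
ordSearch-minimal n (suc fuel) {i} i≤j j<r with (2 ^ suc i) % suc n ≡ᵇ 1 % suc n in found
... | true  = ⊥-elim (<⇒≱ j<r i≤j)
... | false with m≤n⇒m<n∨m≡n i≤j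
...   | inj₁ i<j  = ordSearch-minimal n fuel i<j j<r
...   | inj₂ refl = subst T found ∘ d∣x∸1⇒T[x%d≡ᵇ1%d] (suc n) (m^n>0 2 (suc i))

ordSearch-found : ∀ n fuel i → suc n ∣ 2 ^ suc (ordSearch n fuel i) ∸ 1 ⊎ ordSearch n fuel i ≡ i + fuel
ordSearch-found n zero       i = inj₂ (sym (+-identityʳ i))
ordSearch-found n (suc fuel) i with (2 ^ suc i) % suc n ≡ᵇ 1 % suc n in found
... | true  = inj₁ (T[x%d≡ᵇ1%d]⇒d∣x∸1 {2 ^ suc i} (suc n) (subst T (sym found) _))
... | false = map₂ (λ r≡ → trans r≡ (sym (+-suc i fuel))) (ordSearch-found n fuel (suc i))

instance
  ord₂≢0 : ∀ {d} → NonZero (ord₂ d)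
  ord₂≢0 {zero}  = _
  ord₂≢0 {suc _} = _

-- ord₂ d searches the exponents 1, …, d, and Euler's theorem puts φ d among them.
∣2^ord₂∸1 : ∀ {d} .{{_ : NonZero d}} → Coprime 2 d → d ∣ 2 ^ ord₂ d ∸ 1
∣2^ord₂∸1 {suc n} 2⊥d with ordSearch-found n (suc n) 0
... | inj₁ found = found
... | inj₂ r≡d with φ (suc n) | 0<φ (suc n) | φ≤ (suc n) | euler 2⊥d
...   | suc e | _ | e<d | d∣2^[1+e]∸1 =
  ⊥-elim (ordSearch-minimal n (suc n) z≤n (subst (e <_) (sym r≡d) e<d) d∣2^[1+e]∸1)

ord₂-minimal : ∀ {d t} .{{_ : NonZero d}} → 0 < t → t < ord₂ d → ¬ (d ∣ 2 ^ t ∸ 1)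
ord₂-minimal {suc n} {suc j} _ t<ord = ordSearch-minimal n (suc n) z≤n (s<s⁻¹ t<ord)

ord₂∣⇒∣2^∸1 : ∀ {d t} .{{_ : NonZero d}} → Coprime 2 d → ord₂ d ∣ t → d ∣ 2 ^ t ∸ 1
ord₂∣⇒∣2^∸1 {d} 2⊥d (divides k refl) =
  subst (λ x → d ∣ x ∸ 1) [2^ord₂]^k≡2^[k*ord₂] (∣∸1-^ (∣2^ord₂∸1 2⊥d) k)
  where [2^ord₂]^k≡2^[k*ord₂] = trans (^-*-assoc 2 (ord₂ d) k) (cong (2 ^_) (*-comm (ord₂ d) k))

∣2^∸1⇒∣2^[t%ord₂]∸1 : ∀ {d t} .{{_ : NonZero d}} → Coprime 2 d → d ∣ 2 ^ t ∸ 1 → d ∣ 2 ^ (t % ord₂ d) ∸ 1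
∣2^∸1⇒∣2^[t%ord₂]∸1 {d} {t} 2⊥d d∣2^t∸1 =
  ∣∸1-*-cancelˡ (2 ^ (t / o * o)) (2 ^ (t % o)) {{m^n≢0 2 (t / o * o)}}
    (subst (λ x → d ∣ x ∸ 1) 2^t≡2^[t/o*o]*2^[t%o] d∣2^t∸1) (ord₂∣⇒∣2^∸1 2⊥d (n∣m*n (t / o)))
  where
  o = ord₂ d
  2^t≡2^[t/o*o]*2^[t%o] : 2 ^ t ≡ 2 ^ (t / o * o) * 2 ^ (t % o)
  2^t≡2^[t/o*o]*2^[t%o] = trans (cong (2 ^_) (trans (m≡m%n+[m/n]*n t o) (+-comm (t % o) (t / o * o))))
                                (^-distribˡ-+-* 2 (t / o * o) (t % o))

∣2^∸1⇒ord₂∣ : ∀ {d t} .{{_ : NonZero d}} → Coprime 2 d → d ∣ 2 ^ t ∸ 1 → ord₂ d ∣ t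
∣2^∸1⇒ord₂∣ {d} {t} 2⊥d d∣2^t∸1 with t % ord₂ d in t%o≡r | ∣2^∸1⇒∣2^[t%ord₂]∸1 {t = t} 2⊥d d∣2^t∸1
... | zero  | _       = m%n≡0⇒n∣m t (ord₂ d) t%o≡r
... | suc j | d∣2^r∸1 =
  ⊥-elim (ord₂-minimal {t = suc j} (s≤s z≤n) (subst (_< ord₂ d) t%o≡r (m%n<n t (ord₂ d))) d∣2^r∸1)

ord₂∣φ : ∀ {d} .{{_ : NonZero d}} → Coprime 2 d → ord₂ d ∣ φ d
ord₂∣φ 2⊥d = ∣2^∸1⇒ord₂∣ 2⊥d (euler 2⊥d)

r₂*ord₂≡φ : ∀ {d} .{{_ : NonZero d}} → Coprime 2 d → r₂ d * ord₂ d ≡ φ d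
r₂*ord₂≡φ {suc n} 2⊥d = m/n*n≡m (ord₂∣φ 2⊥d)

ord₂-mono-∣ : ∀ {d e} .{{_ : NonZero d}} .{{_ : NonZero e}} → Coprime 2 e → d ∣ e → ord₂ d ∣ ord₂ e
ord₂-mono-∣ 2⊥e d∣e = ∣2^∸1⇒ord₂∣ (coprime-∣ʳ 2⊥e d∣e) (∣-trans d∣e (∣2^ord₂∸1 2⊥e))

ord₂-*≡lcm : ∀ {a b} .{{_ : NonZero a}} .{{_ : NonZero b}} → Coprime a b → Coprime 2 a → Coprime 2 b →
             ord₂ (a * b) ≡ lcm (ord₂ a) (ord₂ b)
ord₂-*≡lcm {a} {b} a⊥b 2⊥a 2⊥b = ∣-antisym
  (∣2^∸1⇒ord₂∣ 2⊥ab (coprime⇒*∣ a⊥b (ord₂∣⇒∣2^∸1 2⊥a (m∣lcm[m,n] _ _))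
                                    (ord₂∣⇒∣2^∸1 2⊥b (n∣lcm[m,n] (ord₂ a) _))))
  (lcm-least (ord₂-mono-∣ 2⊥ab (m∣m*n b)) (ord₂-mono-∣ 2⊥ab (n∣m*n a)))
  where
  instance _ = m*n≢0 a b
  2⊥ab = coprime-* 2⊥a 2⊥b

-- The Chinese remainder theorem

module _ {m n : ℕ} .{{_ : NonZero m}} .{{_ : NonZero n}} (m⊥n : Coprime m n) where

  residues : ℕ → ℕ × ℕ
  residues k = k % m , k % n

  crt-injective : ∀ {x y} → x < m * n → y < m * n → residues x ≡ residues y → x ≡ y
  crt-injective x<mn y<mn x≡y = ∣∸∧∣∸⇒≡ x<mn y<mn (m*n∣ x≡y) (m*n∣ (sym x≡y))
    where
    m*n∣ : ∀ {x y} → residues x ≡ residues y → m * n ∣ x ∸ y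
    m*n∣ x≡y = coprime⇒*∣ m⊥n (%≡%⇒∣∸ m (cong proj₁ x≡y)) (%≡%⇒∣∸ n (cong proj₂ x≡y))

  upTo²↭residues : cartesianProduct (upTo m) (upTo n) ↭ map residues (upTo (m * n))
  upTo²↭residues = unique-⊆-length≤⇒↭
    (unique-map⁺ residues (λ x∈ y∈ → crt-injective (∈-upTo⁻ x∈) (∈-upTo⁻ y∈)) (upTo⁺ (m * n)))
    (cartesianProduct⁺ (upTo⁺ m) (upTo⁺ n)) residues⊆upTo² (≤-reflexive (begin
      length (cartesianProduct (upTo m) (upTo n)) ≡⟨ length-cartesianProduct (upTo m) (upTo n) ⟩
      length (upTo m) * length (upTo n)           ≡⟨ cong₂ _*_ (length-upTo m) (length-upTo n) ⟩
      m * n                                       ≡⟨ length-upTo (m * n) ⟨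
      length (upTo (m * n))                       ≡⟨ length-map residues (upTo (m * n)) ⟨
      length (map residues (upTo (m * n)))        ∎))
    where
    open ≡-Reasoning
    residues⊆upTo² : map residues (upTo (m * n)) ⊆ cartesianProduct (upTo m) (upTo n)
    residues⊆upTo² w∈image with k , _ , refl ← ∈-map⁻ residues w∈image =
      ∈-cartesianProduct⁺ (∈-upTo⁺ (m%n<n k m)) (∈-upTo⁺ (m%n<n k n))

  crt-surjective : ∀ {i j} → i < m → j < n → ∃[ k ] k < m * n × residues k ≡ (i , j)
  crt-surjective i<m j<n
    with ij∈residues ← ∈-resp-↭ upTo²↭residues (∈-cartesianProduct⁺ (∈-upTo⁺ i<m) (∈-upTo⁺ j<n))
    with k , k∈upTo , ij≡ ← ∈-map⁻ residues ij∈residues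
    = k , ∈-upTo⁻ k∈upTo , sym ij≡

  units²↭residues : cartesianProduct (units m) (units n) ↭ map residues (units (m * n))
  units²↭residues = unique-⊆⊇⇒↭ (unique-map⁺ residues injective (units-unique (m * n)))
    (cartesianProduct⁺ (units-unique m) (units-unique n)) residues⊆units² units²⊆residues
    where
    injective : ∀ {x y} → x ∈ units (m * n) → y ∈ units (m * n) → residues x ≡ residues y → x ≡ y
    injective x∈ y∈ = crt-injective (proj₁ (∈-units⁻ x∈)) (proj₁ (∈-units⁻ y∈))
    residues⊆units² : map residues (units (m * n)) ⊆ cartesianProduct (units m) (units n)
    residues⊆units² w∈image with k , k∈units , refl ← ∈-map⁻ residues w∈image =
      let k⊥mn = proj₂ (∈-units⁻ k∈units) in
      ∈-cartesianProduct⁺ (∈-units⁺ (m%n<n k m) (coprime-%ˡ (coprime-∣ʳ k⊥mn (m∣m*n n))))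
                          (∈-units⁺ (m%n<n k n) (coprime-%ˡ (coprime-∣ʳ k⊥mn (n∣m*n m))))
    units²⊆residues : cartesianProduct (units m) (units n) ⊆ map residues (units (m * n))
    units²⊆residues {i , j} ij∈units²
      with i∈units , j∈units ← ∈-cartesianProduct⁻ (units m) (units n) ij∈units²
      with i<m , i⊥m ← ∈-units⁻ i∈units
      with j<n , j⊥n ← ∈-units⁻ j∈units
      with k , k<mn , refl ← crt-surjective i<m j<n
      = ∈-map⁺ residues (∈-units⁺ k<mn (coprime-* (coprime-%ˡ⁻ i⊥m) (coprime-%ˡ⁻ j⊥n)))

  φ-* : φ (m * n) ≡ φ m * φ n
  φ-* = begin
    φ (m * n)                                      ≡⟨ φ≡length-units (m * n) ⟩
    length (units (m * n))                         ≡⟨ length-map residues (units (m * n)) ⟨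
    length (map residues (units (m * n)))          ≡⟨ ↭-length units²↭residues ⟨
    length (cartesianProduct (units m) (units n))  ≡⟨ length-cartesianProduct (units m) (units n) ⟩
    length (units m) * length (units n)            ≡⟨ cong₂ _*_ (φ≡length-units m) (φ≡length-units n) ⟨
    φ m * φ n                                      ∎
    where open ≡-Reasoning

r₂-* : ∀ {a b} .{{_ : NonZero a}} .{{_ : NonZero b}} → Coprime a b → Coprime 2 a → Coprime 2 b →
       r₂ (a * b) ≡ r₂ a * r₂ b * gcd (ord₂ a) (ord₂ b)
r₂-* {a} {b} a⊥b 2⊥a 2⊥b = *-cancelʳ-≡ _ _ (ord₂ (a * b)) (begin
  r₂ (a * b) * ord₂ (a * b)               ≡⟨ r₂*ord₂≡φ (coprime-* 2⊥a 2⊥b) ⟩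
  φ (a * b)                               ≡⟨ φ-* a⊥b ⟩
  φ a * φ b                               ≡⟨ cong₂ _*_ (r₂*ord₂≡φ 2⊥a) (r₂*ord₂≡φ 2⊥b) ⟨
  (r₂ a * oa) * (r₂ b * ob)               ≡⟨ [m*n]*[o*p]≡[m*o]*[n*p] (r₂ a) oa (r₂ b) ob ⟩
  (r₂ a * r₂ b) * (oa * ob)               ≡⟨ cong (r₂ a * r₂ b *_) (gcd*lcm oa ob) ⟨
  (r₂ a * r₂ b) * (gcd oa ob * lcm oa ob) ≡⟨ *-assoc (r₂ a * r₂ b) _ _ ⟨
  r₂ a * r₂ b * gcd oa ob * lcm oa ob     ≡⟨ cong (r₂ a * r₂ b * gcd oa ob *_) (ord₂-*≡lcm a⊥b 2⊥a 2⊥b) ⟨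
  r₂ a * r₂ b * gcd oa ob * ord₂ (a * b)  ∎)
  where
  open ≡-Reasoning
  instance _ = m*n≢0 a b
  oa = ord₂ a
  ob = ord₂ b

-- Lifting the exponent

binomial-truncated : ∀ c k → ∃[ R ] (1 + c) ^ k ≡ 1 + (k * c + c * c * R)
binomial-truncated c zero    = 0 , cong suc (sym (*-zeroʳ (c * c)))
binomial-truncated c (suc k) with R , [1+c]^k≡ ← binomial-truncated c k =
  R + k + c * R , (begin
    (1 + c) * (1 + c) ^ k                ≡⟨ cong ((1 + c) *_) [1+c]^k≡ ⟩
    (1 + c) * (1 + (k * c + c * c * R))  ≡⟨ solve 3 (λ c k R →
        (con 1 :+ c) :* (con 1 :+ (k :* c :+ c :* c :* R)) :=
        con 1 :+ ((con 1 :+ k) :* c :+ c :* c :* (R :+ k :+ c :* R))) refl c k R ⟩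
    1 + (suc k * c + c * c * (R + k + c * R)) ∎)
  where open ≡-Reasoning

-- (1 + c)^p = 1 + p c + c² R, and both p c and c² are divisible by p^(k+2) once p^(k+1) ∣ c.
∣∸1-lift : ∀ {p x} .{{_ : NonZero x}} k → p ^ suc k ∣ x ∸ 1 → p ^ suc (suc k) ∣ x ^ p ∸ 1
∣∸1-lift {p} {suc c} k p^[1+k]∣c with R , [1+c]^p≡ ← binomial-truncated c p =
  subst (λ y → p ^ suc (suc k) ∣ y ∸ 1) (sym [1+c]^p≡)
    (∣m∣n⇒∣m+n (*-monoʳ-∣ p p^[1+k]∣c) (∣m⇒∣m*n R (*-pres-∣ p∣c p^[1+k]∣c)))
  where p∣c = ∣-trans (m∣m*n {p} (p ^ k)) p^[1+k]∣c

p^[1+j]∣2^[ord₂[p]*p^j]∸1 : ∀ {p} .{{_ : NonZero p}} → Coprime 2 p → ∀ j →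
                            p ^ suc j ∣ 2 ^ (ord₂ p * p ^ j) ∸ 1
p^[1+j]∣2^[ord₂[p]*p^j]∸1 {p} 2⊥p zero =
  subst₂ (λ x y → x ∣ 2 ^ y ∸ 1) (sym (*-identityʳ p)) (sym (*-identityʳ (ord₂ p))) (∣2^ord₂∸1 2⊥p)
p^[1+j]∣2^[ord₂[p]*p^j]∸1 {p} 2⊥p (suc j) =
  subst (λ x → p ^ suc (suc j) ∣ x ∸ 1) [2^[o*p^j]]^p≡2^[o*p^[1+j]]
    (∣∸1-lift {p} {{m^n≢0 2 (o * p ^ j)}} j (p^[1+j]∣2^[ord₂[p]*p^j]∸1 2⊥p j))
  where
  o = ord₂ p
  [2^[o*p^j]]^p≡2^[o*p^[1+j]] : (2 ^ (o * p ^ j)) ^ p ≡ 2 ^ (o * p ^ suc j)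
  [2^[o*p^j]]^p≡2^[o*p^[1+j]] =
    trans (^-*-assoc 2 (o * p ^ j) p) (cong (2 ^_) (trans (*-assoc o (p ^ j) p) (cong (o *_) (*-comm (p ^ j) p))))

ord₂∣ord₂[p^[1+j]] : ∀ {p} .{{_ : NonZero p}} → Coprime 2 p → ∀ j → ord₂ p ∣ ord₂ (p ^ suc j)
ord₂∣ord₂[p^[1+j]] {p} 2⊥p j = ord₂-mono-∣ (coprime-^ 2⊥p (suc j)) (m∣m*n (p ^ j))
  where instance _ = m^n≢0 p (suc j)

ord₂[p^[1+j]]∣ord₂[p]*p^j : ∀ {p} .{{_ : NonZero p}} → Coprime 2 p → ∀ j →
                            ord₂ (p ^ suc j) ∣ ord₂ p * p ^ j
ord₂[p^[1+j]]∣ord₂[p]*p^j {p} 2⊥p j =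
  ∣2^∸1⇒ord₂∣ {{m^n≢0 p (suc j)}} (coprime-^ 2⊥p (suc j)) (p^[1+j]∣2^[ord₂[p]*p^j]∸1 2⊥p j)

gcd-ord₂[p^[1+j]] : ∀ {p x} .{{_ : NonZero p}} → Coprime 2 p → ∀ j → Coprime (p ^ j) x →
                    gcd x (ord₂ (p ^ suc j)) ≡ gcd x (ord₂ p)
gcd-ord₂[p^[1+j]] 2⊥p j = gcd-coprime-factor (ord₂∣ord₂[p^[1+j]] 2⊥p j) (ord₂[p^[1+j]]∣ord₂[p]*p^j 2⊥p j)

-- Divisors

∈-divisors⁻ : ∀ {n k} → k ∈ divisors n → k ∣ n
∈-divisors⁻ {n} k∈divisors = proj₂ (∈-filter⁻ (_∣? n) {xs = map suc (upTo n)} k∈divisors)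

∈-divisors⇒NonZero : ∀ {n k} → k ∈ divisors n → NonZero k
∈-divisors⇒NonZero {n} k∈divisors
  with _ , _ , refl ← ∈-map⁻ suc (proj₁ (∈-filter⁻ (_∣? n) {xs = map suc (upTo n)} k∈divisors)) = _

∈-divisors⁺ : ∀ {n k} .{{_ : NonZero n}} → k ∣ n → k ∈ divisors n
∈-divisors⁺ {n} {zero}  0∣n = ⊥-elim (≢-nonZero⁻¹ n (0∣⇒≡0 0∣n))
∈-divisors⁺ {n} {suc k} k∣n = ∈-filter⁺ (_∣? n) (∈-map⁺ suc (∈-upTo⁺ (∣⇒≤ k∣n))) k∣n

divisors-unique : ∀ n → Unique (divisors n)
divisors-unique n = filter⁺ (_∣? n) (unique-map⁺ suc (λ _ _ → suc-injective) (upTo⁺ n))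

gcd[i*j,a]≡i : ∀ {a b i j} → Coprime a b → i ∣ a → j ∣ b → gcd (i * j) a ≡ i
gcd[i*j,a]≡i {a} {b} {i} {j} a⊥b (divides k a≡k*i) j∣b = begin
  gcd (i * j) a       ≡⟨ cong (gcd (i * j)) a≡i*k ⟩
  gcd (i * j) (i * k) ≡⟨ c*gcd[m,n]≡gcd[cm,cn] i j k ⟨
  i * gcd j k         ≡⟨ cong (i *_) (coprime⇒gcd≡1 j⊥k) ⟩
  i * 1               ≡⟨ *-identityʳ i ⟩
  i                   ∎
  where
  open ≡-Reasoning
  a≡i*k = trans a≡k*i (*-comm k i)
  j⊥k : Coprime j k
  j⊥k = coprime-∣ʳ (coprime-∣ˡ (Coprime.sym a⊥b) j∣b) (divides i a≡i*k)

∣*⇒∃∣×∣ : ∀ {a b k} .{{_ : NonZero a}} → Coprime a b → k ∣ a * b →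
          ∃[ i ] ∃[ j ] i ∣ a × j ∣ b × k ≡ i * j
∣*⇒∃∣×∣ {a} {b} {k} a⊥b k∣ab with gcd[m,n]∣m k a
... | divides j k≡j*g = g , j , gcd[m,n]∣n k a , j∣b , trans k≡j*g (*-comm j g)
  where
  g = gcd k a
  instance _ = ≢-nonZero (gcd[m,n]≢0 k a (inj₂ (≢-nonZero⁻¹ a)))
  k∣b*g : k ∣ b * g
  k∣b*g = subst (k ∣_) (sym (c*gcd[m,n]≡gcd[cm,cn] b k a)) (gcd-greatest (n∣m*n b) (subst (k ∣_) (*-comm a b) k∣ab))
  j∣b : j ∣ b
  j∣b = *-cancelʳ-∣ g (subst (_∣ b * g) k≡j*g k∣b*g)

divisors-*↭ : ∀ {a b} .{{_ : NonZero a}} .{{_ : NonZero b}} → Coprime a b →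
              divisors (a * b) ↭ map (uncurry _*_) (cartesianProduct (divisors a) (divisors b))
divisors-*↭ {a} {b} a⊥b = unique-⊆⊇⇒↭ products-unique (divisors-unique (a * b)) products⊆divisors divisors⊆products
  where
  instance _ = m*n≢0 a b
  pairs = cartesianProduct (divisors a) (divisors b)
  injective : ∀ {x y} → x ∈ pairs → y ∈ pairs → uncurry _*_ x ≡ uncurry _*_ y → x ≡ y
  injective {i , j} {i′ , j′} ij∈pairs i′j′∈pairs ij≡i′j′
    with i∈ , j∈ ← ∈-cartesianProduct⁻ (divisors a) (divisors b) ij∈pairs
    with i′∈ , j′∈ ← ∈-cartesianProduct⁻ (divisors a) (divisors b) i′j′∈pairs
    with refl ← trans (sym (gcd[i*j,a]≡i a⊥b (∈-divisors⁻ {a} i∈) (∈-divisors⁻ {b} j∈)))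
                      (trans (cong (λ x → gcd x a) ij≡i′j′)
                             (gcd[i*j,a]≡i a⊥b (∈-divisors⁻ {a} i′∈) (∈-divisors⁻ {b} j′∈)))
    = cong (i ,_) (*-cancelˡ-≡ j j′ i {{∈-divisors⇒NonZero {a} i∈}} ij≡i′j′)
  products-unique = unique-map⁺ (uncurry _*_) injective (cartesianProduct⁺ (divisors-unique a) (divisors-unique b))
  products⊆divisors : map (uncurry _*_) pairs ⊆ divisors (a * b)
  products⊆divisors k∈products
    with (i , j) , ij∈pairs , refl ← ∈-map⁻ (uncurry _*_) k∈products
    with i∈ , j∈ ← ∈-cartesianProduct⁻ (divisors a) (divisors b) ij∈pairs
    = ∈-divisors⁺ (*-pres-∣ (∈-divisors⁻ {a} i∈) (∈-divisors⁻ {b} j∈))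
  divisors⊆products : divisors (a * b) ⊆ map (uncurry _*_) pairs
  divisors⊆products k∈divisors
    with i , j , i∣a , j∣b , refl ← ∣*⇒∃∣×∣ a⊥b (∈-divisors⁻ {a * b} k∈divisors)
    = ∈-map⁺ (uncurry _*_) (∈-cartesianProduct⁺ (∈-divisors⁺ i∣a) (∈-divisors⁺ j∣b))

¬∣⇒coprime : ∀ {p k} → Prime p → ¬ p ∣ k → Coprime k p
¬∣⇒coprime p-prime p∤k (i∣k , i∣p) with prime⇒irreducible p-prime i∣p
... | inj₁ i≡1 = i≡1
... | inj₂ refl = ⊥-elim (p∤k i∣k)

∣p^s⇒≡p^j : ∀ {p} → Prime p → ∀ s {k} → k ∣ p ^ s → ∃[ j ] j ≤ s × k ≡ p ^ j
∣p^s⇒≡p^j p-prime zero    k∣1 = 0 , z≤n , ∣1⇒≡1 k∣1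
∣p^s⇒≡p^j {p} p-prime (suc s) {k} k∣p^[1+s] with p ∣? k
... | yes (divides k′ refl)
  with j , j≤s , refl ← ∣p^s⇒≡p^j p-prime s {k′}
         (*-cancelʳ-∣ p {{prime⇒nonZero p-prime}} (subst (k′ * p ∣_) (*-comm p (p ^ s)) k∣p^[1+s]))
  = suc j , s≤s j≤s , *-comm (p ^ j) p
... | no p∤k with j , j≤s , k≡p^j ← ∣p^s⇒≡p^j p-prime s (coprime-divisor (¬∣⇒coprime p-prime p∤k) k∣p^[1+s])
  = j , m≤n⇒m≤1+n j≤s , k≡p^j

^-injectiveʳ : ∀ {p i j} → 1 < p → p ^ i ≡ p ^ j → i ≡ j
^-injectiveʳ {p} {i} {j} 1<p p^i≡p^j with <-cmp i j
... | tri< i<j _ _ = ⊥-elim (<⇒≢ (^-monoʳ-< p 1<p i<j) p^i≡p^j)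
... | tri≈ _ i≡j _ = i≡j
... | tri> _ _ j<i = ⊥-elim (<⇒≢ (^-monoʳ-< p 1<p j<i) (sym p^i≡p^j))

^-monoʳ-∣ : ∀ p {i j} → i ≤ j → p ^ i ∣ p ^ j
^-monoʳ-∣ p {i} {j} i≤j = divides (p ^ (j ∸ i))
  (trans (cong (p ^_) (sym (m+[n∸m]≡n i≤j))) (trans (^-distribˡ-+-* p i (j ∸ i)) (*-comm (p ^ i) _)))

divisors-^↭ : ∀ {p} → Prime p → ∀ s → divisors (p ^ s) ↭ map (p ^_) (upTo (suc s))
divisors-^↭ {p} p-prime s = unique-⊆⊇⇒↭ (unique-map⁺ (p ^_) (λ _ _ → ^-injectiveʳ 1<p) (upTo⁺ (suc s)))
  (divisors-unique (p ^ s)) powers⊆divisors divisors⊆powers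
  where
  instance
    _ = prime⇒nonZero p-prime
    _ = m^n≢0 p s
  1<p = nonTrivial⇒n>1 p {{prime⇒nonTrivial p-prime}}
  powers⊆divisors : map (p ^_) (upTo (suc s)) ⊆ divisors (p ^ s)
  powers⊆divisors k∈powers with j , j∈upTo , refl ← ∈-map⁻ (p ^_) k∈powers =
    ∈-divisors⁺ (^-monoʳ-∣ p (s≤s⁻¹ (∈-upTo⁻ j∈upTo)))
  divisors⊆powers : divisors (p ^ s) ⊆ map (p ^_) (upTo (suc s))
  divisors⊆powers k∈divisors with j , j≤s , refl ← ∣p^s⇒≡p^j p-prime s (∈-divisors⁻ {p ^ s} k∈divisors) =
    ∈-map⁺ (p ^_) (∈-upTo⁺ (s≤s j≤s))

i₂-* : ∀ {a b} .{{_ : NonZero a}} .{{_ : NonZero b}} → Coprime a b →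
       i₂ (a * b) ≡ sum (map (λ d → sum (map (λ e → r₂ (d * e)) (divisors b))) (divisors a))
i₂-* {a} {b} a⊥b = begin
  sum (map r₂ (divisors (a * b)))        ≡⟨ sum-↭ (↭-map⁺ r₂ (divisors-*↭ a⊥b)) ⟩
  sum (map r₂ (map (uncurry _*_) pairs)) ≡⟨ cong sum (map-∘ pairs) ⟨
  sum (map (r₂ ∘ uncurry _*_) pairs)     ≡⟨ sum-map-cartesianProduct (r₂ ∘ uncurry _*_) (divisors a) (divisors b) ⟩
  sum (map (λ d → sum (map (λ e → r₂ (d * e)) (divisors b))) (divisors a)) ∎
  where
  open ≡-Reasoning
  pairs = cartesianProduct (divisors a) (divisors b)

sum-map-divisors-^ : ∀ {p} → Prime p → ∀ s (f : ℕ → ℕ) →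
                     sum (map f (divisors (p ^ s))) ≡ f 1 + sumFrom1 s (λ j → f (p ^ j))
sum-map-divisors-^ {p} p-prime s f = begin
  sum (map f (divisors (p ^ s)))          ≡⟨ sum-↭ (↭-map⁺ f (divisors-^↭ p-prime s)) ⟩
  sum (map f (map (p ^_) (upTo (suc s)))) ≡⟨ cong sum (map-∘ (upTo (suc s))) ⟨
  sum (map (f ∘ (p ^_)) (upTo (suc s)))   ≡⟨ sum-map-upTo-suc (f ∘ (p ^_)) s ⟩
  f 1 + sumFrom1 s (λ j → f (p ^ j))      ∎
  where open ≡-Reasoning

sum-map-divisors-prime : ∀ {p} → Prime p → (f : ℕ → ℕ) → sum (map f (divisors p)) ≡ f 1 + f p
sum-map-divisors-prime {p} p-prime f = begin
  sum (map f (divisors p))       ≡⟨ cong (sum ∘ map f ∘ divisors) (*-identityʳ p) ⟨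
  sum (map f (divisors (p ^ 1))) ≡⟨ sum-map-divisors-^ p-prime 1 f ⟩
  f 1 + f (p ^ 1)                ≡⟨ cong (λ x → f 1 + f x) (*-identityʳ p) ⟩
  f 1 + f p                      ∎
  where open ≡-Reasoning

module _ {d p q : ℕ} .{{_ : NonZero d}} .{{_ : NonZero p}} .{{_ : NonZero q}}
         (2⊥d : Coprime 2 d) (2⊥p : Coprime 2 p) (2⊥q : Coprime 2 q) (d⊥p : Coprime d p) (d⊥q : Coprime d q)
         (gcd-ord₂-p≡q : gcd (ord₂ d) (ord₂ p) ≡ gcd (ord₂ d) (ord₂ q)) where

  sumFrom1-r₂[d*p^j]≡r₂[d*q] : ∀ s → Coprime (p ^ (s ∸ 1)) (ord₂ d) →
                               r₂ q ≡ sumFrom1 s (λ j → r₂ (p ^ j)) →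
                               sumFrom1 s (λ j → r₂ (d * p ^ j)) ≡ r₂ (d * q)
  sumFrom1-r₂[d*p^j]≡r₂[d*q] s p^[s∸1]⊥ord₂d r₂q≡ = begin
    sumFrom1 s (λ j → r₂ (d * p ^ j)) ≡⟨ sumFrom1-cong s r₂[d*p^j]≡r₂[p^j]*K ⟩
    sumFrom1 s (λ j → r₂ (p ^ j) * K) ≡⟨ sumFrom1-*-distribʳ s (λ j → r₂ (p ^ j)) K ⟩
    sumFrom1 s (λ j → r₂ (p ^ j)) * K ≡⟨ cong (_* K) r₂q≡ ⟨
    r₂ q * K                          ≡⟨ xy∙z≈y∙xz (r₂ d) (r₂ q) G ⟨
    r₂ d * r₂ q * G                   ≡⟨ r₂-* d⊥q 2⊥d 2⊥q ⟨
    r₂ (d * q)                        ∎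
    where
    open ≡-Reasoning
    G = gcd (ord₂ d) (ord₂ q)
    K = r₂ d * G
    r₂[d*p^j]≡r₂[p^j]*K : ∀ {j} → 1 ≤ j → j ≤ s → r₂ (d * p ^ j) ≡ r₂ (p ^ j) * K
    r₂[d*p^j]≡r₂[p^j]*K {suc j} _ 1+j≤s = begin
      r₂ (d * p ^ suc j)
        ≡⟨ r₂-* (coprime-^ d⊥p (suc j)) 2⊥d (coprime-^ 2⊥p (suc j)) ⟩
      r₂ d * r₂ (p ^ suc j) * gcd (ord₂ d) (ord₂ (p ^ suc j))
        ≡⟨ cong (r₂ d * r₂ (p ^ suc j) *_) gcd[ord₂d,ord₂[p^[1+j]]]≡G ⟩
      r₂ d * r₂ (p ^ suc j) * G
        ≡⟨ xy∙z≈y∙xz (r₂ d) (r₂ (p ^ suc j)) G ⟩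
      r₂ (p ^ suc j) * K
        ∎
      where
      instance _ = m^n≢0 p (suc j)
      p^j⊥ord₂d = coprime-∣ˡ p^[s∸1]⊥ord₂d (^-monoʳ-∣ p (∸-monoˡ-≤ 1 1+j≤s))
      gcd[ord₂d,ord₂[p^[1+j]]]≡G = trans (gcd-ord₂[p^[1+j]] 2⊥p j p^j⊥ord₂d) gcd-ord₂-p≡q

  sum-r₂[d*divisors[p^s]]≡sum-r₂[d*divisors[q]] : Prime p → Prime q →
    ∀ s → Coprime (p ^ (s ∸ 1)) (ord₂ d) → r₂ q ≡ sumFrom1 s (λ j → r₂ (p ^ j)) →
    sum (map (λ e → r₂ (d * e)) (divisors (p ^ s))) ≡ sum (map (λ e → r₂ (d * e)) (divisors q))
  sum-r₂[d*divisors[p^s]]≡sum-r₂[d*divisors[q]] p-prime q-prime s p^[s∸1]⊥ord₂d r₂q≡ = begin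
    sum (map (λ e → r₂ (d * e)) (divisors (p ^ s)))
      ≡⟨ sum-map-divisors-^ p-prime s (λ e → r₂ (d * e)) ⟩
    r₂ (d * 1) + sumFrom1 s (λ j → r₂ (d * p ^ j))
      ≡⟨ cong (r₂ (d * 1) +_) (sumFrom1-r₂[d*p^j]≡r₂[d*q] s p^[s∸1]⊥ord₂d r₂q≡) ⟩
    r₂ (d * 1) + r₂ (d * q)
      ≡⟨ sum-map-divisors-prime q-prime (λ e → r₂ (d * e)) ⟨
    sum (map (λ e → r₂ (d * e)) (divisors q))
      ∎
    where open ≡-Reasoning

-- The argument works for s = 0 as well.
proposition12 : (s p q m : ℕ) → s ≥ 1 → Prime p → p % 2 ≡ 1 → Prime q → q % 2 ≡ 1 →
    gcd m (2 * p * q) ≡ 1 →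
    gcd (p ^ (s ∸ 1)) (ord₂ m) ≡ 1 →
    r₂ q ≡ sumFrom1 s (λ j → r₂ (p ^ j)) →
    gcd (ord₂ p) (ord₂ m) ≡ gcd (ord₂ q) (ord₂ m) →
    i₂ (p ^ s * m) ≡ i₂ (q * m)
proposition12 s p q m _ p-prime p-odd q-prime q-odd gcd[m,2pq]≡1 gcd[p^[s∸1],ord₂m]≡1 r₂q≡ gcd-ord₂-p≡q = begin
  i₂ (p ^ s * m)
    ≡⟨ cong i₂ (*-comm (p ^ s) m) ⟩
  i₂ (m * p ^ s)
    ≡⟨ i₂-* (coprime-^ m⊥p s) ⟩
  sum (map (λ d → sum (map (λ e → r₂ (d * e)) (divisors (p ^ s)))) (divisors m))
    ≡⟨ cong sum (map-cong-local (All.tabulate same-sum)) ⟩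
  sum (map (λ d → sum (map (λ e → r₂ (d * e)) (divisors q))) (divisors m))
    ≡⟨ i₂-* m⊥q ⟨
  i₂ (m * q)
    ≡⟨ cong i₂ (*-comm m q) ⟩
  i₂ (q * m)
    ∎
  where
  open ≡-Reasoning
  m⊥2pq = gcd≡1⇒coprime gcd[m,2pq]≡1
  m⊥p = coprime-∣ʳ m⊥2pq (∣m⇒∣m*n q (n∣m*n 2))
  m⊥q = coprime-∣ʳ m⊥2pq (n∣m*n (2 * p))
  2⊥m = Coprime.sym (coprime-∣ʳ m⊥2pq (∣m⇒∣m*n q (m∣m*n p)))
  gcd-ord₂-m-p≡q = trans (gcd-comm (ord₂ m) (ord₂ p)) (trans gcd-ord₂-p≡q (gcd-comm (ord₂ q) (ord₂ m)))
  instance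
    _ = prime⇒nonZero p-prime
    _ = prime⇒nonZero q-prime
    _ = m^n≢0 p s
    _ = coprime-2⇒NonZero 2⊥m
  same-sum : ∀ {d} → d ∈ divisors m →
             sum (map (λ e → r₂ (d * e)) (divisors (p ^ s))) ≡ sum (map (λ e → r₂ (d * e)) (divisors q))
  same-sum d∈divisors =
    sum-r₂[d*divisors[p^s]]≡sum-r₂[d*divisors[q]] {{d≢0}}
      (coprime-∣ʳ 2⊥m d∣m) (odd⇒coprime-2 p-odd) (odd⇒coprime-2 q-odd)
      (coprime-∣ˡ m⊥p d∣m) (coprime-∣ˡ m⊥q d∣m) (gcd-cong-∣ ord₂d∣ord₂m gcd-ord₂-m-p≡q)
      p-prime q-prime s (coprime-∣ʳ (gcd≡1⇒coprime gcd[p^[s∸1],ord₂m]≡1) ord₂d∣ord₂m) r₂q≡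
    where
    d≢0 = ∈-divisors⇒NonZero {m} d∈divisors
    d∣m = ∈-divisors⁻ {m} d∈divisors
    ord₂d∣ord₂m = ord₂-mono-∣ {{d≢0}} 2⊥m d∣m
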